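{- Let $(T,L,c,r)$ be a rooted WDTAP instance and $v\in V\setminus\{r\}$. If $L^\downarrow_v=\emptyset$, then $v$ is up-independent with respect to $L$. If $L^\uparrow_v=\emptyset$, then $v$ is down-independent with respect to $L$.
   Context: WDTAP instance: oriented tree $T=(V,A)$, links $L\subseteq V\times V$, costs $c\colon L\to\mathbb{R}_{>0}$. For $\ell=(u,v)$, $P_\ell$ is the $u$-$v$ path in the underlying undirected tree traversed from $u$ to $v$; $\overrightarrow{\mathrm{cov}}(\ell)$ is the set of its arcs traversed against their orientation. Rooted: root $r$; up-arcs point towards $r$, down-arcs away; $A_{up},A_{down}$. $T_v=(U_v,A_v)$ is the subtree of descendants of $v$. A link $\ell=(u,w)$ points into $T_v$ if $w\in U_v\setminus\{v\}$ and $u\notin U_v$, and points out of $T_v$ if $u\in U_v\setminus\{v\}$ and $w\notin U_v$; $L^\downarrow_v$ and $L^\uparrow_v$ denote the sets of links of $L$ pointing into and out of $T_v$. $v$ is up-independent w.r.t. $L'$ if for every $\ell\in L'$, $\overrightarrow{\mathrm{cov}}(\ell)\cap A_v\cap A_{up}=\emptyset$ or $\overrightarrow{\mathrm{cov}}(\ell)\subseteq A_v$; down-independent analogously with $A_{down}$. -}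

module Defs where

open import Data.Nat using (ℕ; zero; suc)
open import Data.Fin using (Fin)
open import Data.Bool using (Bool; true; false)
open import Data.Product using (_×_; _,_)
open import Data.Sum using (_⊎_)
open import Data.List using (List)
open import Data.List.Membership.Propositional using (_∈_)
open import Data.Empty using (⊥)
open import Relation.Nullary using (¬_)
open import Relation.Binary.PropositionalEquality using (_≡_; _≢_)

-- Each non-root vertex x has a parent (parent x); the tree arc joining x and
-- (parent x) is identified with x ("the arc of x").  Its orientation is
-- given by (up x): true means the arc is (x , parent x), i.e. it points
-- towards the root (an up-arc); false means (parent x , x) (a down-arc).
-- The depth function witnesses that following parents always reaches the
-- root, i.e. the parent structure really is a tree rooted at root.
record RootedTree (n : ℕ) : Set where
  field
    root       : Fin n
    parent     : Fin n → Fin n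
    up         : Fin n → Bool
    depth      : Fin n → ℕ
    depth-root : depth root ≡ 0
    depth-step : ∀ v → v ≢ root → depth v ≡ suc (depth (parent v))

Link : ℕ → Set
Link n = Fin n × Fin n

module _ {n : ℕ} (T : RootedTree n) where
  open RootedTree T

  data _∈U_ : Fin n → Fin n → Set where
    here  : ∀ {x} → x ∈U x
    there : ∀ {x v} → x ≢ root → parent x ∈U v → x ∈U v

  -- the arc of x lies in A_v  (both endpoints x, parent x in U_v)
  InA : Fin n → Fin n → Set
  InA v x = (x ∈U v) × (x ≢ v)

  IsUp : Fin n → Set
  IsUp x = up x ≡ true

  IsDown : Fin n → Set
  IsDown x = up x ≡ false

  -- The u-w path in the tree consists of the arcs of those x that are
  -- ancestors-or-self of exactly one of u, w.  It traverses the arc of x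
  -- from x to parent x if x is an ancestor-or-self of u (not of w), and from
  -- parent x to x if x is an ancestor-or-self of w (not of u).
  -- cov→(ℓ): arcs of the path traversed against their orientation.
  InCov : Link n → Fin n → Set
  InCov (u , w) x =
    (x ≢ root) ×
    (((u ∈U x) × ¬ (w ∈U x) × IsDown x) ⊎ ((w ∈U x) × ¬ (u ∈U x) × IsUp x))

  PointsInto : Fin n → Link n → Set
  PointsInto v (u , w) = (w ∈U v) × (w ≢ v) × ¬ (u ∈U v)

  PointsOutOf : Fin n → Link n → Set
  PointsOutOf v (u , w) = (u ∈U v) × (u ≢ v) × ¬ (w ∈U v)

  CovInside : Fin n → Link n → Set
  CovInside v ℓ = ∀ x → InCov ℓ x → InA v x

  UpIndependent : Fin n → List (Link n) → Set
  UpIndependent v L = ∀ ℓ → ℓ ∈ L →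
    (∀ x → InCov ℓ x → InA v x → IsUp x → ⊥) ⊎ CovInside v ℓ

  DownIndependent : Fin n → List (Link n) → Set
  DownIndependent v L = ∀ ℓ → ℓ ∈ L →
    (∀ x → InCov ℓ x → InA v x → IsDown x → ⊥) ⊎ CovInside v ℓ

{-# OPTIONS --safe #-}
module Submission where

-- An arc x lies on the path of ℓ = (u , w) exactly when x is an ancestor of one
-- endpoint but not of the other, and it is traversed against its orientation
-- only when it is an up-arc above w or a down-arc above u.  If no link points
-- into T_v, then for every link either w is not a proper descendant of v, in
-- which case no up-arc of A_v can lie above w, or both endpoints lie in U_v, in
-- which case every separating arc lies in A_v.  Down-independence is symmetric.

open import Defs
open import Data.Nat using (ℕ; _≤_; _<_)
open import Data.Nat.Properties using (≤-refl; ≤-trans; ≤-reflexive; ≤-<-trans; <⇒≤; <⇒≱)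
open import Data.Nat.Induction using (<-wellFounded)
open import Data.Fin using (Fin; _≟_)
open import Data.Product using (_×_; _,_)
open import Data.Sum using (_⊎_; inj₁; inj₂)
open import Data.List using (List)
open import Data.List.Membership.Propositional using (_∈_)
open import Induction.WellFounded using (Acc; acc)
open import Relation.Nullary using (¬_; Dec; yes; no; contradiction; ¬?)
open import Relation.Nullary.Decidable using (map′; _×-dec_)
open import Relation.Binary.PropositionalEquality using (_≡_; _≢_; refl; sym; trans)

module _ {n : ℕ} (T : RootedTree n) where
  open RootedTree T

  infix 4 _⊑_
  _⊑_ : Fin n → Fin n → Set
  _⊑_ = _∈U_ T

  ⊑-trans : ∀ {x y z} → x ⊑ y → y ⊑ z → x ⊑ z
  ⊑-trans here         y⊑z = y⊑z
  ⊑-trans (there ne p) y⊑z = there ne (⊑-trans p y⊑z)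

  ⊑-comparable : ∀ {a x y} → a ⊑ x → a ⊑ y → x ⊑ y ⊎ y ⊑ x
  ⊑-comparable here         a⊑y         = inj₁ a⊑y
  ⊑-comparable (there ne p) here        = inj₂ (there ne p)
  ⊑-comparable (there _ p)  (there _ q) = ⊑-comparable p q

  parent-⊑ : ∀ {x v} → x ≢ v → x ⊑ v → parent x ⊑ v
  parent-⊑ x≢v here        = contradiction refl x≢v
  parent-⊑ _   (there _ p) = p

  parent-depth-< : ∀ {x} → x ≢ root → depth (parent x) < depth x
  parent-depth-< {x} x≢r = ≤-reflexive (sym (depth-step x x≢r))

  ⊑-depth-≤ : ∀ {x v} → x ⊑ v → depth v ≤ depth x
  ⊑-depth-≤ here         = ≤-refl
  ⊑-depth-≤ (there ne p) = ≤-trans (⊑-depth-≤ p) (<⇒≤ (parent-depth-< ne))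

  ⊑-antisym : ∀ {x v} → x ⊑ v → v ⊑ x → x ≡ v
  ⊑-antisym here         _   = refl
  ⊑-antisym (there ne p) v⊑x =
    contradiction (⊑-depth-≤ v⊑x) (<⇒≱ (≤-<-trans (⊑-depth-≤ p) (parent-depth-< ne)))

  ⊑-dec-acc : ∀ x v → Acc _<_ (depth x) → Dec (x ⊑ v)
  ⊑-dec-acc x v (acc rs) with x ≟ v | x ≟ root
  ... | yes refl | _        = yes here
  ... | no x≢v   | yes refl = no λ { here → x≢v refl ; (there r≢r _) → r≢r refl }
  ... | no x≢v   | no x≢r   =
    map′ (there x≢r) (parent-⊑ x≢v) (⊑-dec-acc (parent x) v (rs (parent-depth-< x≢r)))

  ⊑-dec : ∀ x v → Dec (x ⊑ v)
  ⊑-dec x v = ⊑-dec-acc x v (<-wellFounded (depth x))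

  InA-dec : ∀ v x → Dec (InA T v x)
  InA-dec v x = ⊑-dec x v ×-dec ¬? (x ≟ v)

  InA-descendant : ∀ {v x w} → InA T v x → w ⊑ x → InA T v w
  InA-descendant {v} {x} {w} (x⊑v , x≢v) w⊑x = ⊑-trans w⊑x x⊑v , w≢v
    where
    w≢v : w ≢ v
    w≢v refl = x≢v (⊑-antisym x⊑v w⊑x)

  separating-arc-InA : ∀ {v a b x} → a ⊑ v → b ⊑ v → a ⊑ x → ¬ b ⊑ x → InA T v x
  separating-arc-InA a⊑v b⊑v a⊑x b⋢x with ⊑-comparable a⊑x a⊑v
  ... | inj₁ x⊑v = x⊑v , λ { refl → b⋢x b⊑v }
  ... | inj₂ v⊑x = contradiction (⊑-trans b⊑v v⊑x) b⋢x

  endpoints-⊑⇒CovInside : ∀ {v u w} → u ⊑ v → w ⊑ v → CovInside T v (u , w)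
  endpoints-⊑⇒CovInside u⊑v w⊑v x (_ , inj₁ (u⊑x , w⋢x , _)) = separating-arc-InA u⊑v w⊑v u⊑x w⋢x
  endpoints-⊑⇒CovInside u⊑v w⊑v x (_ , inj₂ (w⊑x , u⋢x , _)) = separating-arc-InA w⊑v u⊑v w⊑x u⋢x

  InCov-up⇒head-⊑ : ∀ {u w x} → InCov T (u , w) x → IsUp T x → w ⊑ x
  InCov-up⇒head-⊑ (_ , inj₁ (_ , _ , down)) up = contradiction (trans (sym up) down) λ ()
  InCov-up⇒head-⊑ (_ , inj₂ (w⊑x , _ , _))  _  = w⊑x

  InCov-down⇒tail-⊑ : ∀ {u w x} → InCov T (u , w) x → IsDown T x → u ⊑ x
  InCov-down⇒tail-⊑ (_ , inj₁ (u⊑x , _ , _)) _    = u⊑x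
  InCov-down⇒tail-⊑ (_ , inj₂ (_ , _ , up))  down = contradiction (trans (sym up) down) λ ()

  no-link-into⇒UpIndependent : ∀ v L → (∀ ℓ → ℓ ∈ L → ¬ PointsInto T v ℓ) → UpIndependent T v L
  no-link-into⇒UpIndependent v L none-into (u , w) ℓ∈L with InA-dec v w
  ... | no w∉Av = inj₁ λ x x∈cov x∈Av x-up →
                    w∉Av (InA-descendant x∈Av (InCov-up⇒head-⊑ x∈cov x-up))
  ... | yes (w⊑v , w≢v) with ⊑-dec u v
  ...   | yes u⊑v = inj₂ (endpoints-⊑⇒CovInside u⊑v w⊑v)
  ...   | no u⋢v  = contradiction (w⊑v , w≢v , u⋢v) (none-into (u , w) ℓ∈L)

  no-link-out⇒DownIndependent : ∀ v L → (∀ ℓ → ℓ ∈ L → ¬ PointsOutOf T v ℓ) → DownIndependent T v L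
  no-link-out⇒DownIndependent v L none-out (u , w) ℓ∈L with InA-dec v u
  ... | no u∉Av = inj₁ λ x x∈cov x∈Av x-down →
                    u∉Av (InA-descendant x∈Av (InCov-down⇒tail-⊑ x∈cov x-down))
  ... | yes (u⊑v , u≢v) with ⊑-dec w v
  ...   | yes w⊑v = inj₂ (endpoints-⊑⇒CovInside u⊑v w⊑v)
  ...   | no w⋢v  = contradiction (u⊑v , u≢v , w⋢v) (none-out (u , w) ℓ∈L)

proposition8p5 : (n : ℕ) (T : RootedTree n) (L : List (Link n)) (v : Fin n) →
    v ≢ RootedTree.root T →
    ((∀ ℓ → ℓ ∈ L → ¬ PointsInto T v ℓ) → UpIndependent T v L) ×
    ((∀ ℓ → ℓ ∈ L → ¬ PointsOutOf T v ℓ) → DownIndependent T v L)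
proposition8p5 n T L v _ = no-link-into⇒UpIndependent T v L , no-link-out⇒DownIndependent T v L
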